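{- Let $\alpha$ be a non-zero algebraic number and let $R$ be a complete residue system of $\mathbb{Z}[\alpha]/\alpha\mathbb{Z}[\alpha]$, with $J$ and $\wp$ as defined in the context. Then $(\alpha,R)$ is a number system if and only if for every $\beta\in\mathbb{Z}[\alpha]$ the sequence $(J^{(n)}(\beta))_{n\geq 0}$ is eventually periodic and $\wp=\{0\}$.
   Context: A complete residue system of $\mathbb{Z}[\alpha]/\alpha\mathbb{Z}[\alpha]$ is a subset $R\subset\mathbb{Z}[\alpha]$ containing exactly one element of each coset of $\alpha\mathbb{Z}[\alpha]$. For $S\subset\mathbb{C}$, $S[\alpha]:=\{\sum_{j=0}^n f_j\alpha^j : n\in\mathbb{N},\ (f_0,\ldots,f_n)\in S^{n+1}\}$. $M_\alpha\in\mathbb{Z}[x]$ is the primitive minimal polynomial of $\alpha$ over $\mathbb{Q}$. The pair $(\alpha,R)$ is a number system (of $\mathbb{Z}[\alpha]$) if $\mathbb{Z}[\alpha]=R[\alpha]$, $\operatorname{Card}(R)=\max\{2,|M_\alpha(0)|\}$ and $0\in R$. The map $J:\mathbb{Z}[\alpha]\to\mathbb{Z}[\alpha]$ is $J(\beta)=(\beta-r)/\alpha$, where $r$ is the unique element of $R$ with $\beta-r\in\alpha\mathbb{Z}[\alpha]$; $J^{(n)}$ denotes the $n$-th iterate ($J^{(0)}=\mathrm{id}$). $\wp=\{\beta\in\mathbb{Z}[\alpha] : J^{(n)}(\beta)=\beta \text{ for some } n\geq 1\}$. -}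

module Defs where

open import Data.Nat as ℕ using (ℕ; zero; suc; _⊔_)
open import Data.Nat.Divisibility using (_∣_)
open import Data.Integer as ℤ using (ℤ; ∣_∣)
open import Data.Rational as ℚ using (ℚ)
open import Data.List using (List; []; _∷_; map; foldr)
open import Data.Fin using (Fin)
open import Data.Product using (Σ; ∃; _×_; _,_; proj₁; proj₂)
open import Data.Sum using (_⊎_)
open import Relation.Binary.PropositionalEquality using (_≡_; _≢_)

-- Polynomials over a (raw) ring, as coefficient lists (lowest degree
-- first).  Equality of polynomials is coefficientwise (with implicit
-- zero padding), so trailing zeros do not matter.

module PolyOver (A : Set) (0# 1# : A) (_+_ _*_ : A → A → A) (-_ : A → A) where

  Poly : Set
  Poly = List A

  coeff : Poly → ℕ → A
  coeff []       _       = 0#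
  coeff (a ∷ f)  zero    = a
  coeff (a ∷ f)  (suc n) = coeff f n

  _≐_ : Poly → Poly → Set
  f ≐ g = ∀ n → coeff f n ≡ coeff g n

  _⊕_ : Poly → Poly → Poly
  []      ⊕ g       = g
  (a ∷ f) ⊕ []      = a ∷ f
  (a ∷ f) ⊕ (b ∷ g) = (a + b) ∷ (f ⊕ g)

  ⊝_ : Poly → Poly
  ⊝ f = map -_ f

  _⊖_ : Poly → Poly → Poly
  f ⊖ g = f ⊕ (⊝ g)

  _⊛_ : Poly → Poly → Poly
  []      ⊛ g = []
  (a ∷ f) ⊛ g = map (a *_) g ⊕ (0# ∷ (f ⊛ g))

  X : Poly
  X = 0# ∷ 1# ∷ []

  Constant : Poly → Set
  Constant f = ∀ n → coeff f (suc n) ≡ 0#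

open PolyOver ℤ (ℤ.+ 0) (ℤ.+ 1) ℤ._+_ ℤ._*_ (ℤ.-_) public

module Q = PolyOver ℚ ℚ.0ℚ ℚ.1ℚ ℚ._+_ ℚ._*_ (ℚ.-_)

toℚ[x] : Poly → Q.Poly
toℚ[x] = map (λ z → z ℚ./ 1)

Primitive : Poly → Set
Primitive M = ∀ (d : ℕ) → (∀ n → d ∣ ∣ coeff M n ∣) → d ≡ 1

IrreducibleOverℚ : Poly → Set
IrreducibleOverℚ M =
  (Σ ℕ λ n → coeff M (suc n) ≢ ℤ.+ 0) ×
  (∀ (g h : Q.Poly) → toℚ[x] M Q.≐ (g Q.⊛ h) → Q.Constant g ⊎ Q.Constant h)

-- ℤ[α] ≅ ℤ[x]/(M), with α the class of x.  Elements of ℤ[α] are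
-- represented by integer polynomials; equality in ℤ[α] is congruence
-- modulo M.

module ZAlpha (M : Poly) where

  _≈_ : Poly → Poly → Set
  f ≈ g = Σ Poly λ q → (f ⊖ g) ≐ (M ⊛ q)

  0α : Poly
  0α = []

  _isαTimes_ : Poly → Poly → Set
  β isαTimes γ = β ≈ (X ⊛ γ)

  InαZα : Poly → Set
  InαZα β = Σ Poly λ γ → β isαTimes γ

  record IsCompleteResidueSystem (k : ℕ) (R : Fin k → Poly) : Set where
    field
      residue : ∀ (β : Poly) → Σ (Fin k) λ i → Σ Poly λ γ → (β ⊖ R i) isαTimes γ
      unique  : ∀ (β : Poly) (i j : Fin k) →
                InαZα (β ⊖ R i) → InαZα (β ⊖ R j) → i ≡ j

  module _ {k : ℕ} {R : Fin k → Poly} (crs : IsCompleteResidueSystem k R) where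
    open IsCompleteResidueSystem crs

    -- J(β) = (β - r)/α
    J : Poly → Poly
    J β = proj₁ (proj₂ (residue β))

    J^ : ℕ → Poly → Poly
    J^ zero    β = β
    J^ (suc n) β = J (J^ n β)

    EventuallyPeriodic : Poly → Set
    EventuallyPeriodic β =
      Σ ℕ λ m → Σ ℕ λ p → J^ (m ℕ.+ suc p) β ≈ J^ m β

    In℘ : Poly → Set
    In℘ β = Σ ℕ λ n → J^ (suc n) β ≈ β

    ℘IsZero : Set
    ℘IsZero = In℘ 0α × (∀ β → In℘ β → β ≈ 0α)

  digitValue : {k : ℕ} → (Fin k → Poly) → List (Fin k) → Poly
  digitValue R = foldr (λ i acc → R i ⊕ (X ⊛ acc)) []

  IsNumberSystem : (k : ℕ) → (Fin k → Poly) → Set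
  IsNumberSystem k R =
    (∀ (β : Poly) → Σ (List (Fin k)) λ ds → β ≈ digitValue R ds) ×
    (k ≡ 2 ⊔ ∣ coeff M 0 ∣) ×
    (Σ (Fin k) λ i → R i ≈ 0α)

-- Since M(0) ≠ 0,
-- multiplication by α is cancellable, so J(β) is determined up to ≈ by
-- any decomposition β ≈ r + αγ with r ∈ R.
-- The theorem follows: finite expansions give eventual periodicity and
-- ℘ = {0}; conversely every orbit becomes periodic, hence hits ℘ = {0},
-- hence yields an expansion, and |M(0)| = 1 is excluded because then all
-- digits are 0, so 1 ≈ 0, contradicting that M is non-constant.
module Submission where

open import Defs
open import Data.Nat as ℕ using (ℕ; zero; suc)
import Data.Nat.Properties as ℕP
open import Data.Integer as ℤ using (ℤ; +_; _+_; _*_; -_; _-_; ∣_∣; _%_; _/_)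
import Data.Integer.Properties as ℤP
import Data.Integer.DivMod as ℤDM
open import Data.Integer.Tactic.RingSolver using (solve-∀)
open import Data.Fin as Fin using (Fin)
import Data.Fin.Properties as FinP
open import Data.List using (List; []; _∷_; map; length)
open import Data.Product using (Σ; _×_; _,_; proj₁; proj₂)
open import Data.Sum using (_⊎_; inj₁; inj₂)
open import Data.Empty using (⊥-elim)
open import Function.Bundles using (_⇔_; mk⇔)
open import Level using (0ℓ)
open import Relation.Binary.Bundles using (Setoid)
import Relation.Binary.Reasoning.Setoid as SetoidReasoning
open import Relation.Binary.PropositionalEquality
  using (_≡_; _≢_; refl; sym; trans; cong; cong₂; subst; module ≡-Reasoning)
open import Relation.Nullary using (¬_; yes; no)

private
  distrib-+-+ : ∀ a x y u v → a * (x + y) + (u + v) ≡ (a * x + u) + (a * y + v)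
  distrib-+-+ = solve-∀

  distrib-neg : ∀ a x u → a * (- x) + (- u) ≡ - (a * x + u)
  distrib-neg = solve-∀

  neg-minus : ∀ a b → - (a - b) ≡ b - a
  neg-minus = solve-∀

  minus-+-minus : ∀ a b c d → (a - b) + (c - d) ≡ (a + c) - (b + d)
  minus-+-minus = solve-∀

  minus-minus : ∀ a b c → a - (b + c) ≡ (a - b) - c
  minus-minus = solve-∀

  minus-of-representatives : ∀ r a b m → (r + a * m) - (r + b * m) ≡ m * (a - b)
  minus-of-representatives = solve-∀

  minus-via : ∀ t t' r → t - t' ≡ (t - r) - (t' - r)
  minus-via = solve-∀

  *-distribˡ-minus : ∀ m c c' → m * c - m * c' ≡ m * (c - c')
  *-distribˡ-minus = solve-∀

coeff-⊕ : ∀ f g n → coeff (f ⊕ g) n ≡ coeff f n + coeff g n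
coeff-⊕ []      g       n       = sym (ℤP.+-identityˡ _)
coeff-⊕ (a ∷ f) []      n       = sym (ℤP.+-identityʳ _)
coeff-⊕ (a ∷ f) (b ∷ g) zero    = refl
coeff-⊕ (a ∷ f) (b ∷ g) (suc n) = coeff-⊕ f g n

coeff-⊝ : ∀ f n → coeff (⊝ f) n ≡ - coeff f n
coeff-⊝ []      n       = refl
coeff-⊝ (a ∷ f) zero    = refl
coeff-⊝ (a ∷ f) (suc n) = coeff-⊝ f n

coeff-⊖ : ∀ f g n → coeff (f ⊖ g) n ≡ coeff f n - coeff g n
coeff-⊖ f g n = trans (coeff-⊕ f (⊝ g) n) (cong (_+_ (coeff f n)) (coeff-⊝ g n))

coeff-scale : ∀ a g n → coeff (map (a *_) g) n ≡ a * coeff g n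
coeff-scale a []      n       = sym (ℤP.*-zeroʳ a)
coeff-scale a (b ∷ g) zero    = refl
coeff-scale a (b ∷ g) (suc n) = coeff-scale a g n

coeff-⊛-∷ : ∀ a f g n → coeff ((a ∷ f) ⊛ g) n ≡ a * coeff g n + coeff (+ 0 ∷ (f ⊛ g)) n
coeff-⊛-∷ a f g n = trans (coeff-⊕ (map (a *_) g) _ n) (cong (_+ coeff (+ 0 ∷ (f ⊛ g)) n) (coeff-scale a g n))

coeff-⊛-0 : ∀ f g → coeff (f ⊛ g) 0 ≡ coeff f 0 * coeff g 0
coeff-⊛-0 []      g = refl
coeff-⊛-0 (a ∷ f) g = trans (coeff-⊛-∷ a f g 0) (ℤP.+-identityʳ _)

⊛-zeroʳ : ∀ f n → coeff (f ⊛ []) n ≡ + 0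
⊛-zeroʳ []      n       = refl
⊛-zeroʳ (a ∷ f) zero    = refl
⊛-zeroʳ (a ∷ f) (suc n) = ⊛-zeroʳ f n

⊛-zeroˡ : ∀ f g → (∀ n → coeff f n ≡ + 0) → ∀ n → coeff (f ⊛ g) n ≡ + 0
⊛-zeroˡ []      g f≡0 n = refl
⊛-zeroˡ (a ∷ f) g f≡0 n = begin
  coeff ((a ∷ f) ⊛ g) n                   ≡⟨ coeff-⊛-∷ a f g n ⟩
  a * coeff g n + coeff (+ 0 ∷ (f ⊛ g)) n ≡⟨ cong₂ _+_ (cong (_* coeff g n) (f≡0 0)) (shifted n) ⟩
  + 0                                     ∎
  where
  open ≡-Reasoning
  shifted : ∀ n → coeff (+ 0 ∷ (f ⊛ g)) n ≡ + 0
  shifted zero    = refl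
  shifted (suc n) = ⊛-zeroˡ f g (λ m → f≡0 (suc m)) n

⊛-congʳ : ∀ f {g h} → g ≐ h → (f ⊛ g) ≐ (f ⊛ h)
⊛-congʳ []      g≐h n = refl
⊛-congʳ (a ∷ f) {g} {h} g≐h n = begin
  coeff ((a ∷ f) ⊛ g) n                   ≡⟨ coeff-⊛-∷ a f g n ⟩
  a * coeff g n + coeff (+ 0 ∷ (f ⊛ g)) n ≡⟨ cong₂ _+_ (cong (a *_) (g≐h n)) (shifted n) ⟩
  a * coeff h n + coeff (+ 0 ∷ (f ⊛ h)) n ≡⟨ coeff-⊛-∷ a f h n ⟨
  coeff ((a ∷ f) ⊛ h) n                   ∎
  where
  open ≡-Reasoning
  shifted : ∀ n → coeff (+ 0 ∷ (f ⊛ g)) n ≡ coeff (+ 0 ∷ (f ⊛ h)) n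
  shifted zero    = refl
  shifted (suc n) = ⊛-congʳ f g≐h n

⊛-distribˡ : ∀ f g h → (f ⊛ (g ⊕ h)) ≐ ((f ⊛ g) ⊕ (f ⊛ h))
⊛-distribˡ []      g h n = refl
⊛-distribˡ (a ∷ f) g h n = begin
  coeff ((a ∷ f) ⊛ (g ⊕ h)) n
    ≡⟨ coeff-⊛-∷ a f (g ⊕ h) n ⟩
  a * coeff (g ⊕ h) n + coeff (+ 0 ∷ (f ⊛ (g ⊕ h))) n
    ≡⟨ cong₂ _+_ (cong (a *_) (coeff-⊕ g h n)) (shifted n) ⟩
  a * (coeff g n + coeff h n) + (coeff (+ 0 ∷ (f ⊛ g)) n + coeff (+ 0 ∷ (f ⊛ h)) n)
    ≡⟨ distrib-+-+ a _ _ _ _ ⟩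
  (a * coeff g n + coeff (+ 0 ∷ (f ⊛ g)) n) + (a * coeff h n + coeff (+ 0 ∷ (f ⊛ h)) n)
    ≡⟨ cong₂ _+_ (coeff-⊛-∷ a f g n) (coeff-⊛-∷ a f h n) ⟨
  coeff ((a ∷ f) ⊛ g) n + coeff ((a ∷ f) ⊛ h) n
    ≡⟨ coeff-⊕ ((a ∷ f) ⊛ g) _ n ⟨
  coeff (((a ∷ f) ⊛ g) ⊕ ((a ∷ f) ⊛ h)) n
    ∎
  where
  open ≡-Reasoning
  shifted : ∀ n → coeff (+ 0 ∷ (f ⊛ (g ⊕ h))) n
                ≡ coeff (+ 0 ∷ (f ⊛ g)) n + coeff (+ 0 ∷ (f ⊛ h)) n
  shifted zero    = refl
  shifted (suc n) = trans (⊛-distribˡ f g h n) (coeff-⊕ (f ⊛ g) _ n)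

⊛-negʳ : ∀ f g → (f ⊛ (⊝ g)) ≐ (⊝ (f ⊛ g))
⊛-negʳ []      g n = refl
⊛-negʳ (a ∷ f) g n = begin
  coeff ((a ∷ f) ⊛ (⊝ g)) n                        ≡⟨ coeff-⊛-∷ a f (⊝ g) n ⟩
  a * coeff (⊝ g) n + coeff (+ 0 ∷ (f ⊛ (⊝ g))) n  ≡⟨ cong₂ _+_ (cong (a *_) (coeff-⊝ g n)) (shifted n) ⟩
  a * (- coeff g n) + (- coeff (+ 0 ∷ (f ⊛ g)) n)  ≡⟨ distrib-neg a _ _ ⟩
  - (a * coeff g n + coeff (+ 0 ∷ (f ⊛ g)) n)      ≡⟨ cong -_ (coeff-⊛-∷ a f g n) ⟨
  - coeff ((a ∷ f) ⊛ g) n                          ≡⟨ coeff-⊝ ((a ∷ f) ⊛ g) n ⟨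
  coeff (⊝ ((a ∷ f) ⊛ g)) n                        ∎
  where
  open ≡-Reasoning
  shifted : ∀ n → coeff (+ 0 ∷ (f ⊛ (⊝ g))) n ≡ - coeff (+ 0 ∷ (f ⊛ g)) n
  shifted zero    = refl
  shifted (suc n) = trans (⊛-negʳ f g n) (coeff-⊝ (f ⊛ g) n)

⊛-shiftʳ : ∀ f g → (f ⊛ (+ 0 ∷ g)) ≐ (+ 0 ∷ (f ⊛ g))
⊛-shiftʳ []      g zero    = refl
⊛-shiftʳ []      g (suc n) = refl
⊛-shiftʳ (a ∷ f) g zero    = trans (coeff-⊛-0 (a ∷ f) (+ 0 ∷ g)) (ℤP.*-zeroʳ a)
⊛-shiftʳ (a ∷ f) g (suc n) = begin
  coeff ((a ∷ f) ⊛ (+ 0 ∷ g)) (suc n)   ≡⟨ coeff-⊛-∷ a f (+ 0 ∷ g) (suc n) ⟩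
  a * coeff g n + coeff (f ⊛ (+ 0 ∷ g)) n ≡⟨ cong (_+_ (a * coeff g n)) (⊛-shiftʳ f g n) ⟩
  a * coeff g n + coeff (+ 0 ∷ (f ⊛ g)) n ≡⟨ coeff-⊛-∷ a f g n ⟨
  coeff ((a ∷ f) ⊛ g) n                 ∎
  where open ≡-Reasoning

⊛-identityˡ : ∀ g → ((+ 1 ∷ []) ⊛ g) ≐ g
⊛-identityˡ g n = begin
  coeff ((+ 1 ∷ []) ⊛ g) n                 ≡⟨ coeff-⊛-∷ (+ 1) [] g n ⟩
  + 1 * coeff g n + coeff (+ 0 ∷ []) n     ≡⟨ cong₂ _+_ (ℤP.*-identityˡ (coeff g n)) (zero-coeff n) ⟩
  coeff g n + + 0                          ≡⟨ ℤP.+-identityʳ _ ⟩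
  coeff g n                                ∎
  where
  open ≡-Reasoning
  zero-coeff : ∀ n → coeff (+ 0 ∷ []) n ≡ + 0
  zero-coeff zero    = refl
  zero-coeff (suc n) = refl

X⊛ : ∀ g → (X ⊛ g) ≐ (+ 0 ∷ g)
X⊛ g n = begin
  coeff (X ⊛ g) n                                    ≡⟨ coeff-⊛-∷ (+ 0) (+ 1 ∷ []) g n ⟩
  + 0 * coeff g n + coeff (+ 0 ∷ ((+ 1 ∷ []) ⊛ g)) n ≡⟨ ℤP.+-identityˡ _ ⟩
  coeff (+ 0 ∷ ((+ 1 ∷ []) ⊛ g)) n                   ≡⟨ shifted n ⟩
  coeff (+ 0 ∷ g) n                                  ∎
  where
  open ≡-Reasoning
  shifted : ∀ n → coeff (+ 0 ∷ ((+ 1 ∷ []) ⊛ g)) n ≡ coeff (+ 0 ∷ g) n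
  shifted zero    = refl
  shifted (suc n) = ⊛-identityˡ g n

⊕-identityʳ : ∀ f → (f ⊕ []) ≡ f
⊕-identityʳ []      = refl
⊕-identityʳ (a ∷ f) = refl

tail : Poly → Poly
tail []      = []
tail (a ∷ f) = f

constant-zero⇒shift : ∀ f → coeff f 0 ≡ + 0 → f ≐ (+ 0 ∷ tail f)
constant-zero⇒shift []      f0≡0 zero    = refl
constant-zero⇒shift []      f0≡0 (suc n) = refl
constant-zero⇒shift (a ∷ f) f0≡0 zero    = f0≡0
constant-zero⇒shift (a ∷ f) f0≡0 (suc n) = refl

⊖-cong : ∀ {f f' g g'} → f ≐ f' → g ≐ g' → (f ⊖ g) ≐ (f' ⊖ g')
⊖-cong {f} {f'} {g} {g'} f≐f' g≐g' n = begin
  coeff (f ⊖ g) n        ≡⟨ coeff-⊖ f g n ⟩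
  coeff f n - coeff g n   ≡⟨ cong₂ _-_ (f≐f' n) (g≐g' n) ⟩
  coeff f' n - coeff g' n ≡⟨ coeff-⊖ f' g' n ⟨
  coeff (f' ⊖ g') n      ∎
  where open ≡-Reasoning

X⊛-⊖ : ∀ f g → ((X ⊛ f) ⊖ (X ⊛ g)) ≐ (+ 0 ∷ (f ⊖ g))
X⊛-⊖ f g = ⊖-cong {X ⊛ f} {+ 0 ∷ f} {X ⊛ g} {+ 0 ∷ g} (X⊛ f) (X⊛ g)

-- Degrees, used only to show that a non-constant polynomial is not
-- invertible in ℤ[x].

DegreeAtMost : Poly → ℕ → Set
DegreeAtMost f d = ∀ n → d ℕ.< n → coeff f n ≡ + 0

zero-or-degree : ∀ f → (∀ n → coeff f n ≡ + 0)
                     ⊎ Σ ℕ λ d → coeff f d ≢ + 0 × DegreeAtMost f d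
zero-or-degree []      = inj₁ (λ _ → refl)
zero-or-degree (a ∷ f) with zero-or-degree f
... | inj₂ (d , fd≢0 , deg) = inj₂ (suc d , fd≢0 , λ { zero () ; (suc n) (ℕ.s≤s d<n) → deg n d<n })
... | inj₁ f≡0 with a ℤ.≟ + 0
...   | yes a≡0 = inj₁ (λ { zero → a≡0 ; (suc n) → f≡0 n })
...   | no  a≢0 = inj₂ (0 , a≢0 , λ { zero () ; (suc n) _ → f≡0 n })

coeff-⊛-top : ∀ f g d e → DegreeAtMost f d → DegreeAtMost g e →
              coeff (f ⊛ g) (d ℕ.+ e) ≡ coeff f d * coeff g e
coeff-⊛-top []      g d       e degf degg = sym (ℤP.*-zeroˡ (coeff g e))
coeff-⊛-top (a ∷ f) g zero    e degf degg =
  trans (coeff-⊛-∷ a f g e) (trans (cong (_+_ (a * coeff g e)) (shifted e)) (ℤP.+-identityʳ _))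
  where
  shifted : ∀ n → coeff (+ 0 ∷ (f ⊛ g)) n ≡ + 0
  shifted zero    = refl
  shifted (suc n) = ⊛-zeroˡ f g (λ m → degf (suc m) (ℕ.s≤s ℕ.z≤n)) n
coeff-⊛-top (a ∷ f) g (suc d) e degf degg = begin
  coeff ((a ∷ f) ⊛ g) (suc (d ℕ.+ e))                 ≡⟨ coeff-⊛-∷ a f g (suc (d ℕ.+ e)) ⟩
  a * coeff g (suc (d ℕ.+ e)) + coeff (f ⊛ g) (d ℕ.+ e) ≡⟨ cong₂ _+_ beyond-g
                                                           (coeff-⊛-top f g d e (λ n d<n → degf (suc n) (ℕ.s≤s d<n)) degg) ⟩
  + 0 + coeff f d * coeff g e                          ≡⟨ ℤP.+-identityˡ _ ⟩
  coeff f d * coeff g e                                ∎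
  where
  open ≡-Reasoning
  beyond-g : a * coeff g (suc (d ℕ.+ e)) ≡ + 0
  beyond-g = trans (cong (a *_) (degg _ (ℕ.s≤s (ℕP.m≤n+m e d)))) (ℤP.*-zeroʳ a)

NonConstant : Poly → Set
NonConstant M = Σ ℕ λ n → coeff M (suc n) ≢ + 0

nonconstant-not-unit : ∀ M q → NonConstant M → ¬ ((+ 1 ∷ []) ≐ (M ⊛ q))
nonconstant-not-unit M q (n , Mn≢0) 1≐Mq with zero-or-degree M | zero-or-degree q
... | inj₁ M≡0                | _ = Mn≢0 (M≡0 (suc n))
... | inj₂ (zero , _ , degM)  | _ = Mn≢0 (degM (suc n) (ℕ.s≤s ℕ.z≤n))
... | inj₂ (suc d , _ , _)    | inj₁ q≡0 =
  one≢zero (trans (1≐Mq 0) (trans (coeff-⊛-0 M q) (trans (cong (coeff M 0 *_) (q≡0 0)) (ℤP.*-zeroʳ (coeff M 0)))))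
  where
  one≢zero : + 1 ≢ + 0
  one≢zero ()
... | inj₂ (suc d , Md≢0 , degM) | inj₂ (e , qe≢0 , degq)
  with ℤP.i*j≡0⇒i≡0∨j≡0 (coeff M (suc d))
         (trans (sym (coeff-⊛-top M q (suc d) e degM degq)) (sym (1≐Mq (suc (d ℕ.+ e)))))
...   | inj₁ Md≡0 = Md≢0 Md≡0
...   | inj₂ qe≡0 = qe≢0 qe≡0

-- Part 2.  Congruence modulo M, i.e. equality in ℤ[α].

module Congruence (M : Poly) where
  open ZAlpha M

  -- membership in the ideal (M) of ℤ[x]; f ≈ g says exactly that
  -- f ⊖ g ∈ (M).  A record, so that h can be inferred from InIdeal h.
  record InIdeal (h : Poly) : Set where
    constructor _,_
    field
      quotient      : Poly
      factorisation : h ≐ (M ⊛ quotient)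

  ideal-resp : ∀ {h h'} → h ≐ h' → InIdeal h → InIdeal h'
  ideal-resp h≐h' (q , h≐Mq) = q , λ n → trans (sym (h≐h' n)) (h≐Mq n)

  ideal-zero : ∀ {h} → (∀ n → coeff h n ≡ + 0) → InIdeal h
  ideal-zero h≡0 = [] , λ n → trans (h≡0 n) (sym (⊛-zeroʳ M n))

  ideal-⊕ : ∀ {h h'} → InIdeal h → InIdeal h' → InIdeal (h ⊕ h')
  ideal-⊕ {h} {h'} (q , h≐Mq) (q' , h'≐Mq') = q ⊕ q' , λ n → begin
    coeff (h ⊕ h') n                    ≡⟨ coeff-⊕ h h' n ⟩
    coeff h n + coeff h' n              ≡⟨ cong₂ _+_ (h≐Mq n) (h'≐Mq' n) ⟩
    coeff (M ⊛ q) n + coeff (M ⊛ q') n  ≡⟨ coeff-⊕ (M ⊛ q) _ n ⟨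
    coeff ((M ⊛ q) ⊕ (M ⊛ q')) n        ≡⟨ ⊛-distribˡ M q q' n ⟨
    coeff (M ⊛ (q ⊕ q')) n              ∎
    where open ≡-Reasoning

  ideal-⊝ : ∀ {h} → InIdeal h → InIdeal (⊝ h)
  ideal-⊝ {h} (q , h≐Mq) = ⊝ q , λ n → begin
    coeff (⊝ h) n         ≡⟨ coeff-⊝ h n ⟩
    - coeff h n           ≡⟨ cong -_ (h≐Mq n) ⟩
    - coeff (M ⊛ q) n     ≡⟨ coeff-⊝ (M ⊛ q) n ⟨
    coeff (⊝ (M ⊛ q)) n   ≡⟨ ⊛-negʳ M q n ⟨
    coeff (M ⊛ (⊝ q)) n   ∎
    where open ≡-Reasoning

  ideal-shift : ∀ {h} → InIdeal h → InIdeal (+ 0 ∷ h)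
  ideal-shift (q , h≐Mq) = + 0 ∷ q , λ
    { zero    → sym (⊛-shiftʳ M q 0)
    ; (suc n) → trans (h≐Mq n) (sym (⊛-shiftʳ M q (suc n))) }

  -- … and x can be cancelled when M(0) ≠ 0: from x·h = M·q the constant
  -- term gives M(0)·q(0) = 0, so q = x·q' and h = M·q'
  ideal-unshift : coeff M 0 ≢ + 0 → ∀ {h} → InIdeal (+ 0 ∷ h) → InIdeal h
  ideal-unshift M0≢0 (q , xh≐Mq) = tail q , λ n →
    trans (xh≐Mq (suc n)) (trans (⊛-congʳ M q≐xq' (suc n)) (⊛-shiftʳ M (tail q) (suc n)))
    where
    q0≡0 : coeff q 0 ≡ + 0
    q0≡0 with ℤP.i*j≡0⇒i≡0∨j≡0 (coeff M 0) (trans (sym (coeff-⊛-0 M q)) (sym (xh≐Mq 0)))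
    ... | inj₁ M0≡0 = ⊥-elim (M0≢0 M0≡0)
    ... | inj₂ q0≡0 = q0≡0
    q≐xq' : q ≐ (+ 0 ∷ tail q)
    q≐xq' = constant-zero⇒shift q q0≡0

  -- equality in ℤ[α], as a record so that f and g are inferable
  infix 4 _≋_
  record _≋_ (f g : Poly) : Set where
    constructor ⟨_⟩
    field difference : InIdeal (f ⊖ g)

  ≋⇒≈ : ∀ {f g} → f ≋ g → f ≈ g
  ≋⇒≈ ⟨ q , p ⟩ = q , p

  ≈⇒≋ : ∀ {f g} → f ≈ g → f ≋ g
  ≈⇒≋ (q , p) = ⟨ q , p ⟩

  ≐⇒≋ : ∀ {f g} → f ≐ g → f ≋ g
  ≐⇒≋ {f} {g} f≐g = ⟨ ideal-zero (λ n → begin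
    coeff (f ⊖ g) n        ≡⟨ coeff-⊖ f g n ⟩
    coeff f n - coeff g n  ≡⟨ cong (_-_ (coeff f n)) (f≐g n) ⟨
    coeff f n - coeff f n  ≡⟨ ℤP.+-inverseʳ (coeff f n) ⟩
    + 0                    ∎) ⟩
    where open ≡-Reasoning

  ≋-refl : ∀ {f} → f ≋ f
  ≋-refl = ≐⇒≋ (λ _ → refl)

  ≋-sym : ∀ {f g} → f ≋ g → g ≋ f
  ≋-sym {f} {g} ⟨ f≈g ⟩ = ⟨ ideal-resp coeffs (ideal-⊝ f≈g) ⟩
    where
    coeffs : (⊝ (f ⊖ g)) ≐ (g ⊖ f)
    coeffs n = begin
      coeff (⊝ (f ⊖ g)) n         ≡⟨ coeff-⊝ (f ⊖ g) n ⟩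
      - coeff (f ⊖ g) n           ≡⟨ cong -_ (coeff-⊖ f g n) ⟩
      - (coeff f n - coeff g n)   ≡⟨ neg-minus (coeff f n) (coeff g n) ⟩
      coeff g n - coeff f n       ≡⟨ coeff-⊖ g f n ⟨
      coeff (g ⊖ f) n             ∎
      where open ≡-Reasoning

  ≋-trans : ∀ {f g h} → f ≋ g → g ≋ h → f ≋ h
  ≋-trans {f} {g} {h} ⟨ f≈g ⟩ ⟨ g≈h ⟩ = ⟨ ideal-resp coeffs (ideal-⊕ f≈g g≈h) ⟩
    where
    coeffs : ((f ⊖ g) ⊕ (g ⊖ h)) ≐ (f ⊖ h)
    coeffs n = begin
      coeff ((f ⊖ g) ⊕ (g ⊖ h)) n                   ≡⟨ coeff-⊕ (f ⊖ g) _ n ⟩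
      coeff (f ⊖ g) n + coeff (g ⊖ h) n             ≡⟨ cong₂ _+_ (coeff-⊖ f g n) (coeff-⊖ g h n) ⟩
      (coeff f n - coeff g n) + (coeff g n - coeff h n) ≡⟨ ℤP.+-minus-telescope (coeff f n) (coeff g n) (coeff h n) ⟩
      coeff f n - coeff h n                         ≡⟨ coeff-⊖ f h n ⟨
      coeff (f ⊖ h) n                               ∎
      where open ≡-Reasoning

  ≋-setoid : Setoid 0ℓ 0ℓ
  ≋-setoid = record
    { Carrier       = Poly
    ; _≈_           = _≋_
    ; isEquivalence = record { refl = ≋-refl ; sym = ≋-sym ; trans = ≋-trans } }

  module ≋-Reasoning = SetoidReasoning ≋-setoid

  ⊕-cong : ∀ {f f' g g'} → f ≋ f' → g ≋ g' → (f ⊕ g) ≋ (f' ⊕ g')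
  ⊕-cong {f} {f'} {g} {g'} ⟨ f≈f' ⟩ ⟨ g≈g' ⟩ = ⟨ ideal-resp coeffs (ideal-⊕ f≈f' g≈g') ⟩
    where
    coeffs : ((f ⊖ f') ⊕ (g ⊖ g')) ≐ ((f ⊕ g) ⊖ (f' ⊕ g'))
    coeffs n = begin
      coeff ((f ⊖ f') ⊕ (g ⊖ g')) n                       ≡⟨ coeff-⊕ (f ⊖ f') _ n ⟩
      coeff (f ⊖ f') n + coeff (g ⊖ g') n                 ≡⟨ cong₂ _+_ (coeff-⊖ f f' n) (coeff-⊖ g g' n) ⟩
      (coeff f n - coeff f' n) + (coeff g n - coeff g' n) ≡⟨ minus-+-minus (coeff f n) (coeff f' n) (coeff g n) (coeff g' n) ⟩
      (coeff f n + coeff g n) - (coeff f' n + coeff g' n) ≡⟨ cong₂ _-_ (coeff-⊕ f g n) (coeff-⊕ f' g' n) ⟨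
      coeff (f ⊕ g) n - coeff (f' ⊕ g') n                 ≡⟨ coeff-⊖ (f ⊕ g) _ n ⟨
      coeff ((f ⊕ g) ⊖ (f' ⊕ g')) n                       ∎
      where open ≡-Reasoning

  ⊖≋⇒≋⊕ : ∀ {f g h} → (f ⊖ g) ≋ h → f ≋ (g ⊕ h)
  ⊖≋⇒≋⊕ {f} {g} {h} ⟨ p ⟩ = ⟨ ideal-resp coeffs p ⟩
    where
    coeffs : ((f ⊖ g) ⊖ h) ≐ (f ⊖ (g ⊕ h))
    coeffs n = begin
      coeff ((f ⊖ g) ⊖ h) n                 ≡⟨ coeff-⊖ (f ⊖ g) h n ⟩
      coeff (f ⊖ g) n - coeff h n           ≡⟨ cong (_- coeff h n) (coeff-⊖ f g n) ⟩
      (coeff f n - coeff g n) - coeff h n   ≡⟨ minus-minus (coeff f n) (coeff g n) (coeff h n) ⟨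
      coeff f n - (coeff g n + coeff h n)   ≡⟨ cong (_-_ (coeff f n)) (coeff-⊕ g h n) ⟨
      coeff f n - coeff (g ⊕ h) n           ≡⟨ coeff-⊖ f (g ⊕ h) n ⟨
      coeff (f ⊖ (g ⊕ h)) n                 ∎
      where open ≡-Reasoning

  ≋⊕⇒⊖≋ : ∀ {f g h} → f ≋ (g ⊕ h) → (f ⊖ g) ≋ h
  ≋⊕⇒⊖≋ {f} {g} {h} ⟨ p ⟩ = ⟨ ideal-resp coeffs p ⟩
    where
    coeffs : (f ⊖ (g ⊕ h)) ≐ ((f ⊖ g) ⊖ h)
    coeffs n = begin
      coeff (f ⊖ (g ⊕ h)) n                 ≡⟨ coeff-⊖ f (g ⊕ h) n ⟩
      coeff f n - coeff (g ⊕ h) n           ≡⟨ cong (_-_ (coeff f n)) (coeff-⊕ g h n) ⟩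
      coeff f n - (coeff g n + coeff h n)   ≡⟨ minus-minus (coeff f n) (coeff g n) (coeff h n) ⟩
      (coeff f n - coeff g n) - coeff h n   ≡⟨ cong (_- coeff h n) (coeff-⊖ f g n) ⟨
      coeff (f ⊖ g) n - coeff h n           ≡⟨ coeff-⊖ (f ⊖ g) h n ⟨
      coeff ((f ⊖ g) ⊖ h) n                 ∎
      where open ≡-Reasoning

  X⊛-cong : ∀ {f g} → f ≋ g → (X ⊛ f) ≋ (X ⊛ g)
  X⊛-cong {f} {g} ⟨ f≈g ⟩ = ⟨ ideal-resp (λ n → sym (X⊛-⊖ f g n)) (ideal-shift f≈g) ⟩

  multiple-of-M : ∀ q → (M ⊛ q) ≋ []
  multiple-of-M q = ⟨ q , (λ n → cong (λ f → coeff f n) (⊕-identityʳ (M ⊛ q))) ⟩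

  X⊛-zero : (X ⊛ []) ≋ []
  X⊛-zero = ≐⇒≋ (⊛-zeroʳ X)

  X⊛-cancel : coeff M 0 ≢ + 0 → ∀ {f g} → (X ⊛ f) ≋ (X ⊛ g) → f ≋ g
  X⊛-cancel M0≢0 {f} {g} ⟨ αf≈αg ⟩ = ⟨ ideal-unshift M0≢0 (ideal-resp (X⊛-⊖ f g) αf≈αg) ⟩

-- Part 3.  Orbits of J and digit expansions.

module Expansion (M : Poly) (M0≢0 : coeff M 0 ≢ + 0)
                 {k : ℕ} {R : Fin k → Poly}
                 (crs : ZAlpha.IsCompleteResidueSystem M k R) where
  open ZAlpha M
  open Congruence M
  open IsCompleteResidueSystem crs

  digit : Poly → Fin k
  digit β = proj₁ (residue β)

  J-residue : ∀ β → (β ⊖ R (digit β)) ≋ (X ⊛ J crs β)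
  J-residue β = ≈⇒≋ (proj₂ (proj₂ (residue β)))

  J-spec : ∀ β → β ≋ (R (digit β) ⊕ (X ⊛ J crs β))
  J-spec β = ⊖≋⇒≋⊕ (J-residue β)

  -- J(β) is determined by any decomposition β ≈ r + αγ with r ∈ R:
  -- uniqueness of the residue fixes r, cancellation of α fixes γ
  J-unique : ∀ {β γ} i → β ≋ (R i ⊕ (X ⊛ γ)) → J crs β ≋ γ
  J-unique {β} {γ} i β≋r+αγ = X⊛-cancel M0≢0 (≋-trans (≋-sym (J-residue β)) β-r≋αγ')
    where
    β-r≋αγ : (β ⊖ R i) ≋ (X ⊛ γ)
    β-r≋αγ = ≋⊕⇒⊖≋ β≋r+αγ
    same-digit : digit β ≡ i
    same-digit = unique β (digit β) i (J crs β , ≋⇒≈ (J-residue β)) (γ , ≋⇒≈ β-r≋αγ)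
    β-r≋αγ' : (β ⊖ R (digit β)) ≋ (X ⊛ γ)
    β-r≋αγ' = subst (λ j → (β ⊖ R j) ≋ (X ⊛ γ)) (sym same-digit) β-r≋αγ

  J-cong : ∀ {β β'} → β ≋ β' → J crs β ≋ J crs β'
  J-cong {β} {β'} β≋β' = J-unique (digit β') (≋-trans β≋β' (J-spec β'))

  J^-cong : ∀ n {β β'} → β ≋ β' → J^ crs n β ≋ J^ crs n β'
  J^-cong zero    β≋β' = β≋β'
  J^-cong (suc n) β≋β' = J-cong (J^-cong n β≋β')

  J^-+ : ∀ a b β → J^ crs (a ℕ.+ b) β ≡ J^ crs a (J^ crs b β)
  J^-+ zero    b β = refl
  J^-+ (suc a) b β = cong (J crs) (J^-+ a b β)

  J^-suc : ∀ n β → J^ crs (suc n) β ≡ J^ crs n (J crs β)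
  J^-suc zero    β = refl
  J^-suc (suc n) β = cong (J crs) (J^-suc n β)

  J-preserves-periodic : ∀ n {β} → J^ crs (suc n) β ≋ β → J^ crs (suc n) (J crs β) ≋ J crs β
  J-preserves-periodic n {β} period =
    subst (_≋ J crs β) (J^-suc (suc n) β) (J-cong period)

  periodic-tail : ∀ m p {β} → J^ crs (m ℕ.+ suc p) β ≋ J^ crs m β →
                  J^ crs (suc p) (J^ crs m β) ≋ J^ crs m β
  periodic-tail m p {β} =
    subst (_≋ J^ crs m β) (trans (cong (λ t → J^ crs t β) (ℕP.+-comm m (suc p))) (J^-+ (suc p) m β))

  -- each application of J strips one digit off an expansion
  J^-expansion : ∀ ds {β} → β ≋ digitValue R ds → J^ crs (length ds) β ≋ []
  J^-expansion []       β≋0  = β≋0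
  J^-expansion (d ∷ ds) {β} β≋dds =
    subst (_≋ []) (sym (J^-suc (length ds) β)) (J^-expansion ds (J-unique d β≋dds))

  -- conversely an orbit reaching 0 yields an expansion: the digits of the
  -- points along the orbit
  expansion-of-orbit : ∀ m β → J^ crs m β ≋ [] → Σ (List (Fin k)) λ ds → β ≋ digitValue R ds
  expansion-of-orbit zero    β β≋0   = [] , β≋0
  expansion-of-orbit (suc m) β Jmβ≋0 =
    let ds , Jβ≋ds = expansion-of-orbit m (J crs β) (subst (_≋ []) (J^-suc m β) Jmβ≋0)
    in  digit β ∷ ds , ≋-trans (J-spec β) (⊕-cong (≋-refl {R (digit β)}) (X⊛-cong Jβ≋ds))

  zero-digit⇒J0≋0 : ∀ i → R i ≋ [] → J crs [] ≋ []
  zero-digit⇒J0≋0 i Ri≋0 = J-unique i (≋-sym (⊕-cong Ri≋0 X⊛-zero))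

  J0≋0⇒zero-digit : J crs [] ≋ [] → R (digit []) ≋ []
  J0≋0⇒zero-digit J0≋0 = begin
    R (digit [])                      ≡⟨ ⊕-identityʳ (R (digit [])) ⟨
    R (digit []) ⊕ []                 ≈⟨ ⊕-cong (≋-refl {R (digit [])}) (≋-trans (X⊛-cong J0≋0) X⊛-zero) ⟨
    R (digit []) ⊕ (X ⊛ J crs [])     ≈⟨ J-spec [] ⟨
    []                                ∎
    where open ≋-Reasoning

  zero-digits-value : (∀ i → R i ≋ []) → ∀ ds → digitValue R ds ≋ []
  zero-digits-value R≋0 []       = ≋-refl
  zero-digits-value R≋0 (d ∷ ds) = ⊕-cong (R≋0 d) (≋-trans (X⊛-cong (zero-digits-value R≋0 ds)) X⊛-zero)

  module _ (J0≋0 : J crs [] ≋ []) where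

    orbit-stays-zero : ∀ n {β} → β ≋ [] → J^ crs n β ≋ []
    orbit-stays-zero zero    β≋0 = β≋0
    orbit-stays-zero (suc n) β≋0 = ≋-trans (J-cong (orbit-stays-zero n β≋0)) J0≋0

    reaching-zero⇒eventually-periodic : ∀ m {β} → J^ crs m β ≋ [] → EventuallyPeriodic crs β
    reaching-zero⇒eventually-periodic m {β} Jmβ≋0 = m , 0 , ≋⇒≈ (begin
      J^ crs (m ℕ.+ 1) β   ≡⟨ cong (λ t → J^ crs t β) (ℕP.+-comm m 1) ⟩
      J crs (J^ crs m β)   ≈⟨ orbit-stays-zero 1 Jmβ≋0 ⟩
      []                   ≈⟨ Jmβ≋0 ⟨
      J^ crs m β           ∎)
      where open ≋-Reasoning

    -- a periodic point whose orbit reaches 0 is 0: it equals J^(m·(n+1)) β,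
    -- and J^(m·(n+1)) β = J^(m·n) (J^m β) ≈ 0
    periodic-reaching-zero : ∀ m n {β} → J^ crs m β ≋ [] → J^ crs (suc n) β ≋ β → β ≋ []
    periodic-reaching-zero m n {β} Jmβ≋0 period = begin
      β                                ≈⟨ iterate m ⟨
      J^ crs (m ℕ.* suc n) β           ≡⟨ cong (λ t → J^ crs t β) m[n+1]≡mn+m ⟩
      J^ crs (m ℕ.* n ℕ.+ m) β         ≡⟨ J^-+ (m ℕ.* n) m β ⟩
      J^ crs (m ℕ.* n) (J^ crs m β)    ≈⟨ orbit-stays-zero (m ℕ.* n) Jmβ≋0 ⟩
      []                               ∎
      where
      open ≋-Reasoning
      iterate : ∀ t → J^ crs (t ℕ.* suc n) β ≋ β
      iterate zero    = ≋-refl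
      iterate (suc t) = subst (_≋ β) (sym (J^-+ (suc n) (t ℕ.* suc n) β))
                              (≋-trans (J^-cong (suc n) (iterate t)) period)
      m[n+1]≡mn+m : m ℕ.* suc n ≡ m ℕ.* n ℕ.+ m
      m[n+1]≡mn+m = trans (ℕP.*-suc m n) (ℕP.+-comm m (m ℕ.* n))

-- Part 4.  The number of residue classes is |M(0)|.

remainder-unique : ∀ m r r' c → r ℕ.< ∣ m ∣ → r' ℕ.< ∣ m ∣ → + r - + r' ≡ m * c → r ≡ r'
remainder-unique m r r' c r<m r'<m r-r'≡mc with c ℤ.≟ + 0
... | yes c≡0 = ℤP.+-injective (ℤP.i-j≡0⇒i≡j (+ r) (+ r')
                  (trans r-r'≡mc (trans (cong (m *_) c≡0) (ℤP.*-zeroʳ m))))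
... | no  c≢0 = ⊥-elim (ℕP.<⇒≱ ∣r-r'∣<m m≤∣r-r'∣)
  where
  instance
    c-nonZero : ℤ.NonZero c
    c-nonZero = ℤ.≢-nonZero c≢0
  -- |r − r'| ≤ max r r' < |m| …
  ∣r-r'∣<m : ∣ + r - + r' ∣ ℕ.< ∣ m ∣
  ∣r-r'∣<m = ℕP.≤-<-trans (subst (ℕ._≤ r ℕ.⊔ r') (cong ∣_∣ (sym (ℤP.m-n≡m⊖n r r'))) (ℤP.∣m⊝n∣≤m⊔n r r'))
                          (ℕP.⊔-lub r<m r'<m)
  -- … but |r − r'| = |m|·|c| ≥ |m|
  m≤∣r-r'∣ : ∣ m ∣ ℕ.≤ ∣ + r - + r' ∣
  m≤∣r-r'∣ = subst (∣ m ∣ ℕ.≤_) (sym (trans (cong ∣_∣ r-r'≡mc) (ℤP.abs-* m c))) (ℕP.m≤m*n ∣ m ∣ ∣ c ∣)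

module Counting (M : Poly) (M0≢0 : coeff M 0 ≢ + 0)
                {k : ℕ} {R : Fin k → Poly}
                (crs : ZAlpha.IsCompleteResidueSystem M k R) where
  open ZAlpha M
  open Congruence M
  open Expansion M M0≢0 crs using (digit; J-residue)
  open IsCompleteResidueSystem crs

  αℤ[α]⇒M0∣ : ∀ h → InαZα h → Σ ℤ λ c → coeff h 0 ≡ coeff M 0 * c
  αℤ[α]⇒M0∣ h (γ , q , h-αγ≐Mq) = coeff q 0 , (begin
    coeff h 0                        ≡⟨ ℤP.+-identityʳ (coeff h 0) ⟨
    coeff h 0 - + 0                  ≡⟨ cong (_-_ (coeff h 0)) (X⊛ γ 0) ⟨
    coeff h 0 - coeff (X ⊛ γ) 0      ≡⟨ coeff-⊖ h (X ⊛ γ) 0 ⟨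
    coeff (h ⊖ (X ⊛ γ)) 0            ≡⟨ h-αγ≐Mq 0 ⟩
    coeff (M ⊛ q) 0                  ≡⟨ coeff-⊛-0 M q ⟩
    coeff M 0 * coeff q 0            ∎)
    where open ≡-Reasoning

  -- conversely, if h(0) = M(0)·c then h ≈ h − M·c, which has constant term
  -- 0 and so is α times its tail
  M0∣⇒αℤ[α] : ∀ h c → coeff h 0 ≡ coeff M 0 * c → InαZα h
  M0∣⇒αℤ[α] h c h0≡M0c = tail D , ≋⇒≈ (begin
    h                  ≈⟨ ⊖≋⇒≋⊕ {g = M ⊛ (c ∷ [])} ≋-refl ⟩
    (M ⊛ (c ∷ [])) ⊕ D ≈⟨ ⊕-cong (multiple-of-M (c ∷ [])) (≋-refl {D}) ⟩
    D                  ≈⟨ ≐⇒≋ (λ n → trans (constant-zero⇒shift D D0≡0 n) (sym (X⊛ (tail D) n))) ⟩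
    X ⊛ tail D         ∎)
    where
    open ≋-Reasoning
    D : Poly
    D = h ⊖ (M ⊛ (c ∷ []))
    D0≡0 : coeff D 0 ≡ + 0
    D0≡0 = trans (coeff-⊖ h (M ⊛ (c ∷ [])) 0)
             (trans (cong₂ _-_ h0≡M0c (coeff-⊛-0 M (c ∷ []))) (ℤP.+-inverseʳ (coeff M 0 * c)))

  N : ℕ
  N = ∣ coeff M 0 ∣

  instance
    M0-nonZero : ℤ.NonZero (coeff M 0)
    M0-nonZero = ℤ.≢-nonZero M0≢0

  remainder-of : Fin k → Fin N
  remainder-of i = Fin.fromℕ< (ℤDM.n%d<d (coeff (R i) 0) (coeff M 0))

  -- equal remainders put R i − R j into αℤ[α], forcing i = j
  remainder-of-injective : ∀ {i j} → remainder-of i ≡ remainder-of j → i ≡ j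
  remainder-of-injective {i} {j} same =
    unique (R i) i j (M0∣⇒αℤ[α] (R i ⊖ R i) (+ 0) Ri-Ri0≡0) (M0∣⇒αℤ[α] (R i ⊖ R j) (qi - qj) Ri-Rj0≡M0[qi-qj])
    where
    m ri rj qi qj : ℤ
    m = coeff M 0
    ri = coeff (R i) 0
    rj = coeff (R j) 0
    qi = ri / m
    qj = rj / m
    same-remainder : ri % m ≡ rj % m
    same-remainder = trans (sym (FinP.toℕ-fromℕ< _)) (trans (cong Fin.toℕ same) (FinP.toℕ-fromℕ< _))
    Ri-Ri0≡0 : coeff (R i ⊖ R i) 0 ≡ m * + 0
    Ri-Ri0≡0 = trans (coeff-⊖ (R i) (R i) 0) (trans (ℤP.+-inverseʳ ri) (sym (ℤP.*-zeroʳ m)))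
    Ri-Rj0≡M0[qi-qj] : coeff (R i ⊖ R j) 0 ≡ m * (qi - qj)
    Ri-Rj0≡M0[qi-qj] = begin
      coeff (R i ⊖ R j) 0                           ≡⟨ coeff-⊖ (R i) (R j) 0 ⟩
      ri - rj                                       ≡⟨ cong₂ _-_ (ℤDM.a≡a%n+[a/n]*n ri m) (ℤDM.a≡a%n+[a/n]*n rj m) ⟩
      (+ (ri % m) + qi * m) - (+ (rj % m) + qj * m) ≡⟨ cong (λ x → (+ (ri % m) + qi * m) - (+ x + qj * m)) same-remainder ⟨
      (+ (ri % m) + qi * m) - (+ (ri % m) + qj * m) ≡⟨ minus-of-representatives (+ (ri % m)) qi qj m ⟩
      m * (qi - qj)                                 ∎
      where open ≡-Reasoning

  residue-of-constant : Fin N → Fin k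
  residue-of-constant t = digit (+ Fin.toℕ t ∷ [])

  constant-congruence : ∀ t → Σ ℤ λ c → + t - coeff (R (digit (+ t ∷ []))) 0 ≡ coeff M 0 * c
  constant-congruence t =
    let c , t-r≡M0c = αℤ[α]⇒M0∣ (β ⊖ R (digit β)) (J crs β , ≋⇒≈ (J-residue β))
    in  c , trans (sym (coeff-⊖ β (R (digit β)) 0)) t-r≡M0c
    where
    β : Poly
    β = + t ∷ []

  residue-of-constant-injective : ∀ {t t'} → residue-of-constant t ≡ residue-of-constant t' → t ≡ t'
  residue-of-constant-injective {t} {t'} same =
    FinP.toℕ-injective (remainder-unique m (Fin.toℕ t) (Fin.toℕ t') (c - c')
                          (FinP.toℕ<n t) (FinP.toℕ<n t') t-t'≡m[c-c'])
    where
    m r c c' : ℤ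
    m = coeff M 0
    r = coeff (R (residue-of-constant t)) 0
    c = proj₁ (constant-congruence (Fin.toℕ t))
    c' = proj₁ (constant-congruence (Fin.toℕ t'))
    t-r≡mc : + Fin.toℕ t - r ≡ m * c
    t-r≡mc = proj₂ (constant-congruence (Fin.toℕ t))
    t'-r≡mc' : + Fin.toℕ t' - r ≡ m * c'
    t'-r≡mc' = subst (λ i → + Fin.toℕ t' - coeff (R i) 0 ≡ m * c') (sym same)
                     (proj₂ (constant-congruence (Fin.toℕ t')))
    t-t'≡m[c-c'] : + Fin.toℕ t - + Fin.toℕ t' ≡ m * (c - c')
    t-t'≡m[c-c'] = begin
      + Fin.toℕ t - + Fin.toℕ t'                 ≡⟨ minus-via (+ Fin.toℕ t) (+ Fin.toℕ t') r ⟩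
      (+ Fin.toℕ t - r) - (+ Fin.toℕ t' - r)     ≡⟨ cong₂ _-_ t-r≡mc t'-r≡mc' ⟩
      m * c - m * c'                             ≡⟨ *-distribˡ-minus m c c' ⟩
      m * (c - c')                               ∎
      where open ≡-Reasoning

  residue-count : k ≡ N
  residue-count = ℕP.≤-antisym (FinP.injective⇒≤ remainder-of-injective)
                               (FinP.injective⇒≤ residue-of-constant-injective)

Fin-1-trivial : ∀ {k} → k ≡ 1 → (i j : Fin k) → i ≡ j
Fin-1-trivial refl Fin.zero Fin.zero = refl

module Characterisation (M : Poly) (M0≢0 : coeff M 0 ≢ + 0)
                        {k : ℕ} {R : Fin k → Poly}
                        (crs : ZAlpha.IsCompleteResidueSystem M k R) where
  open ZAlpha M
  open Congruence M
  open Expansion M M0≢0 crs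
  open Counting M M0≢0 crs using (N; residue-count)

  -- in a number system the zero digit gives J 0 ≈ 0, and the orbit of β
  -- reaches 0 after as many steps as β has digits
  number-system⇒dynamics : IsNumberSystem k R → (∀ β → EventuallyPeriodic crs β) × ℘IsZero crs
  number-system⇒dynamics (expansion , _ , i , Ri≈0) =
    eventually-periodic , (0 , ≋⇒≈ J0≋0) , periodic-is-zero
    where
    J0≋0 : J crs [] ≋ []
    J0≋0 = zero-digit⇒J0≋0 i (≈⇒≋ Ri≈0)
    steps : Poly → ℕ
    steps β = length (proj₁ (expansion β))
    reaches-zero : ∀ β → J^ crs (steps β) β ≋ []
    reaches-zero β = J^-expansion (proj₁ (expansion β)) (≈⇒≋ (proj₂ (expansion β)))
    eventually-periodic : ∀ β → EventuallyPeriodic crs β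
    eventually-periodic β = reaching-zero⇒eventually-periodic J0≋0 (steps β) (reaches-zero β)
    periodic-is-zero : ∀ β → In℘ crs β → β ≈ []
    periodic-is-zero β (n , period) =
      ≋⇒≈ (periodic-reaching-zero J0≋0 (steps β) n (reaches-zero β) (≈⇒≋ period))

  module _ (periodic : ∀ β → EventuallyPeriodic crs β) (℘≡0 : ℘IsZero crs) where

    periodic-point-is-zero : ∀ {β} n → J^ crs (suc n) β ≋ β → β ≋ []
    periodic-point-is-zero {β} n period = ≈⇒≋ (proj₂ ℘≡0 β (n , ≋⇒≈ period))

    -- J 0 ∈ ℘ since 0 ∈ ℘, hence J 0 ≈ 0
    J0≋0 : J crs [] ≋ []
    J0≋0 = let n , period = proj₁ ℘≡0
           in  periodic-point-is-zero n (J-preserves-periodic n (≈⇒≋ period))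

    -- the periodic part J^m β of an orbit lies in ℘ = {0}
    orbit-reaches-zero : ∀ β → Σ ℕ λ m → J^ crs m β ≋ []
    orbit-reaches-zero β = let m , p , period = periodic β
                           in  m , periodic-point-is-zero p (periodic-tail m p (≈⇒≋ period))

    expansions : ∀ β → Σ (List (Fin k)) λ ds → β ≈ digitValue R ds
    expansions β =
      let m , Jmβ≋0 = orbit-reaches-zero β
          ds , β≋ds  = expansion-of-orbit m β Jmβ≋0
      in  ds , ≋⇒≈ β≋ds

    -- |M(0)| = 1 is impossible: R would consist of the zero digit alone,
    -- so every expansion, in particular that of 1, would have value 0
    N≢1 : NonConstant M → N ≢ 1
    N≢1 nonconstant N≡1 = let ⟨ q , 1≐Mq ⟩ = one≋0 in nonconstant-not-unit M q nonconstant 1≐Mq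
      where
      all-digits-zero : ∀ i → R i ≋ []
      all-digits-zero i = subst (λ j → R j ≋ []) (Fin-1-trivial (trans residue-count N≡1) (digit []) i)
                                (J0≋0⇒zero-digit J0≋0)
      one≋0 : (+ 1 ∷ []) ≋ []
      one≋0 = let ds , one≈ds = expansions (+ 1 ∷ [])
              in  ≋-trans (≈⇒≋ one≈ds) (zero-digits-value all-digits-zero ds)

    dynamics⇒number-system : NonConstant M → IsNumberSystem k R
    dynamics⇒number-system nonconstant =
      expansions , card , digit [] , ≋⇒≈ (J0≋0⇒zero-digit J0≋0)
      where
      2≤N : 2 ℕ.≤ N
      2≤N = ℕP.≤∧≢⇒< (ℕP.n≢0⇒n>0 (λ N≡0 → M0≢0 (ℤP.∣i∣≡0⇒i≡0 N≡0)))
                     (λ 1≡N → N≢1 nonconstant (sym 1≡N))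
      card : k ≡ 2 ℕ.⊔ N
      card = trans residue-count (sym (ℕP.m≤n⇒m⊔n≡n 2≤N))

-- The theorem.

corollary1 : (M : Poly) → Primitive M → IrreducibleOverℚ M →
             coeff M 0 ≢ + 0 →
             (k : ℕ) (R : Fin k → Poly) →
             (crs : ZAlpha.IsCompleteResidueSystem M k R) →
             ZAlpha.IsNumberSystem M k R ⇔
               ((∀ (β : Poly) → ZAlpha.EventuallyPeriodic M crs β) ×
                ZAlpha.℘IsZero M crs)
corollary1 M _ irreducible M0≢0 k R crs =
  mk⇔ number-system⇒dynamics
      (λ (periodic , ℘≡0) → dynamics⇒number-system periodic ℘≡0 (proj₁ irreducible))
  where open Characterisation M M0≢0 crs
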